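{- Let $3\le k\le n$ and let $G$ be a graph of order $n$. If $\tau_k(G)+\tau_k(\bar G)=n-k$, then $\Delta(G)-\delta(G)\le k-1$.
   Context: $\bar G$ is the complement of $G$; $\Delta(G)$ and $\delta(G)$ denote maximum and minimum degree. For $S\subseteq V(G)$ with $|S|\ge 2$, a pedant $S$-Steiner tree is a subgraph of $G$ that is a tree containing $S$ in which every vertex of $S$ has degree exactly one. Two pedant $S$-Steiner trees $T,T'$ are internally disjoint if $E(T)\cap E(T')=\emptyset$ and $V(T)\cap V(T')=S$. $\tau_G(S)$ is the maximum number of pairwise internally disjoint pedant $S$-Steiner trees in $G$, and $\tau_k(G)=\min\{\tau_G(S): S\subseteq V(G),\ |S|=k\}$; by convention $\tau_k(G)=0$ when $G$ is disconnected. -}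

module Defs where

open import Data.Nat using (ℕ; zero; suc; _+_; _*_; _∸_; _⊔_; _⊓_; _≤_)
open import Data.Empty using (⊥-elim)
open import Data.Bool using (Bool; true; false; not; if_then_else_)
open import Data.Fin using (Fin; zero; suc)
open import Data.Fin.Properties using (_≟_)
open import Data.Fin.Subset using (Subset; _∈_; ∣_∣)
open import Data.Product using (Σ; _×_; _,_)
open import Function using (_∘_)
open import Relation.Nullary using (¬_; yes; no)
open import Relation.Binary.PropositionalEquality using (_≡_; refl; sym; trans)

record Graph (n : ℕ) : Set where
  field
    adj    : Fin n → Fin n → Bool
    adj-sym    : ∀ u v → adj u v ≡ adj v u
    adj-irrefl : ∀ v → adj v v ≡ false
open Graph public

complement : ∀ {n} → Graph n → Graph n
complement {n} G = record { adj = cadj ; adj-sym = csym ; adj-irrefl = cirr }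
  where
  cadj : Fin n → Fin n → Bool
  cadj u v with u ≟ v
  ... | yes _ = false
  ... | no  _ = not (adj G u v)
  csym : ∀ u v → cadj u v ≡ cadj v u
  csym u v with u ≟ v | v ≟ u
  ... | yes _ | yes _ = refl
  ... | yes p | no q = ⊥-elim (q (sym p))
  ... | no p | yes q = ⊥-elim (p (sym q))
  ... | no _ | no _ rewrite adj-sym G u v = refl
  cirr : ∀ v → cadj v v ≡ false
  cirr v with v ≟ v
  ... | yes _ = refl
  ... | no p = ⊥-elim (p refl)

countTrue : ∀ {n} → (Fin n → Bool) → ℕ
countTrue {zero} f = 0
countTrue {suc n} f = (if f zero then 1 else 0) + countTrue (f ∘ suc)

degree : ∀ {n} → Graph n → Fin n → ℕ
degree G v = countTrue (adj G v)

maxF : ∀ {n} → (Fin n → ℕ) → ℕ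
maxF {zero} f = 0
maxF {suc n} f = f zero ⊔ maxF (f ∘ suc)

-- minimum (convention: 0 for the empty vertex set, never used below)
minF : ∀ {n} → (Fin n → ℕ) → ℕ
minF {zero} f = 0
minF {suc zero} f = f zero
minF {suc (suc n)} f = f zero ⊓ minF (f ∘ suc)

Δ : ∀ {n} → Graph n → ℕ
Δ G = maxF (degree G)

δ : ∀ {n} → Graph n → ℕ
δ G = minF (degree G)

data Reach {n : ℕ} (E : Fin n → Fin n → Bool) : Fin n → Fin n → Set where
  here : ∀ {u} → Reach E u u
  step : ∀ {u w v} → E u w ≡ true → Reach E w v → Reach E u v

-- number of edges of a symmetric irreflexive edge relation, counted twice
-- (number of ordered adjacent pairs)
twiceEdges : ∀ {n} → (Fin n → Fin n → Bool) → ℕ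
twiceEdges {n} E = sumF (λ u → countTrue (E u))
  where
  sumF : ∀ {m} → (Fin m → ℕ) → ℕ
  sumF {zero} f = 0
  sumF {suc m} f = f zero + sumF (f ∘ suc)

record SubTree {n : ℕ} (G : Graph n) : Set where
  field
    V : Subset n
    E : Fin n → Fin n → Bool
    E-sym    : ∀ u v → E u v ≡ E v u
    E-irrefl : ∀ v → E v v ≡ false
    E⊆G      : ∀ u v → E u v ≡ true → adj G u v ≡ true
    E-ends   : ∀ u v → E u v ≡ true → u ∈ V
    connected : ∀ u v → u ∈ V → v ∈ V → Reach E u v
    edgeCount : twiceEdges E + 2 ≡ 2 * ∣ V ∣
open SubTree public

record PedantSteinerTree {n : ℕ} (G : Graph n) (S : Subset n) : Set where
  field
    tree     : SubTree G
    S⊆V      : ∀ v → v ∈ S → v ∈ V tree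
    pendant  : ∀ v → v ∈ S → countTrue (E tree v) ≡ 1
open PedantSteinerTree public

InternallyDisjoint : ∀ {n} {G : Graph n} {S : Subset n} →
  PedantSteinerTree G S → PedantSteinerTree G S → Set
InternallyDisjoint {n} {G} {S} T T' =
  (∀ u v → ¬ (E (tree T) u v ≡ true × E (tree T') u v ≡ true)) ×
  (∀ v → v ∈ V (tree T) → v ∈ V (tree T') → v ∈ S)

HasDisjointTrees : ∀ {n} → Graph n → Subset n → ℕ → Set
HasDisjointTrees G S t =
  Σ (Fin t → PedantSteinerTree G S) λ T →
    ∀ i j → ¬ i ≡ j → InternallyDisjoint (T i) (T j)

IsTauS : ∀ {n} → Graph n → Subset n → ℕ → Set
IsTauS G S t = HasDisjointTrees G S t × ¬ HasDisjointTrees G S (suc t)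

IsTau : ∀ {n} → ℕ → Graph n → ℕ → Set
IsTau {n} k G t =
  (∀ (S : Subset n) → ∣ S ∣ ≡ k → ∀ s → IsTauS G S s → t ≤ s) ×
  Σ (Subset n) λ S → ∣ S ∣ ≡ k × IsTauS G S t

module Submission where

open import Defs
open import Data.Nat using (ℕ; _+_; _∸_; _≤_)
open import Relation.Binary.PropositionalEquality using (_≡_)

-- Let S be a k-set containing a vertex v.  Every pedant
-- S-Steiner tree contains exactly one edge at v, and internally disjoint
-- trees use different such edges, so τ_G(S) ≤ deg_G(v).  Hence
-- τ_k(G) ≤ δ(G), and likewise τ_k(Ḡ) ≤ δ(Ḡ) = n - 1 - Δ(G).  Therefore
--   n - k = τ_k(G) + τ_k(Ḡ) ≤ δ(G) + n - 1 - Δ(G),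
-- i.e. Δ(G) ≤ δ(G) + k - 1 (this only needs 1 ≤ k ≤ n).

open import Data.Nat using (zero; suc; _<_; z≤n; s≤s; _≤?_)
open import Data.Nat.Properties as ℕₚ using (≤-trans; +-suc; +-comm; +-assoc)
open import Data.Bool using (Bool; true; false; not; if_then_else_)
open import Data.Fin using (Fin; zero; suc)
open import Data.Fin.Properties using (_≟_; suc-injective; injective⇒≤)
open import Data.Fin.Subset using (Subset; _∈_; ∣_∣; ⊤; ⊥)
open import Data.Fin.Subset.Properties using (∣⊥∣≡0; ∣⊤∣≡n; ∈⊤)
open import Data.Vec using (_∷_)
open import Data.Vec.Base using (here; there)
open import Data.Product using (∃; _×_; _,_; proj₁; proj₂)
open import Data.Sum using (inj₁; inj₂)
open import Data.Empty using (⊥-elim) renaming (⊥ to Empty)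
open import Function using (_∘_)
open import Relation.Nullary using (¬_; yes; no; contradiction)
open import Relation.Nullary.Decidable using (decidable-stable)
open import Relation.Binary.PropositionalEquality using (refl; sym; trans; cong; subst; module ≡-Reasoning)

countTrue-cong : ∀ {n} (f g : Fin n → Bool) → (∀ w → f w ≡ g w) →
  countTrue f ≡ countTrue g
countTrue-cong {zero} f g f≗g = refl
countTrue-cong {suc n} f g f≗g rewrite f≗g zero =
  cong (_ +_) (countTrue-cong (f ∘ suc) (g ∘ suc) (f≗g ∘ suc))

countTrue-not : ∀ {n} (f : Fin n → Bool) → countTrue f + countTrue (not ∘ f) ≡ n
countTrue-not {zero} f = refl
countTrue-not {suc n} f with f zero
... | true  = cong suc (countTrue-not (f ∘ suc))
... | false = trans (+-suc (countTrue (f ∘ suc)) _) (cong suc (countTrue-not (f ∘ suc)))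

countTrue-flip : ∀ {n} (f g : Fin n → Bool) u → f u ≡ false → g u ≡ true →
  (∀ w → ¬ w ≡ u → f w ≡ g w) → suc (countTrue f) ≡ countTrue g
countTrue-flip {suc n} f g zero fu gu f≗g rewrite fu | gu =
  cong suc (countTrue-cong (f ∘ suc) (g ∘ suc) (λ w → f≗g (suc w) λ ()))
countTrue-flip {suc n} f g (suc u) fu gu f≗g rewrite f≗g zero (λ ()) =
  trans (sym (+-suc (if g zero then 1 else 0) _))
    (cong ((if g zero then 1 else 0) +_) (countTrue-flip (f ∘ suc) (g ∘ suc) u fu gu
                    (λ w w≢u → f≗g (suc w) (w≢u ∘ suc-injective))))

countTrue-witness : ∀ {n} (f : Fin n → Bool) {c} → countTrue f ≡ suc c →
  ∃ λ w → f w ≡ true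
countTrue-witness {suc n} f eq with f zero in f0
... | true  = zero , f0
... | false = let (w , fw) = countTrue-witness (f ∘ suc) eq in suc w , fw

rank : ∀ {n} (f : Fin n → Bool) w → f w ≡ true → Fin (countTrue f)
rank {suc n} f zero fw with f zero
rank f zero refl | true = zero
rank {suc n} f (suc w) fw with f zero
... | true  = suc (rank (f ∘ suc) w fw)
... | false = rank (f ∘ suc) w fw

rank-injective : ∀ {n} (f : Fin n → Bool) w w' (fw : f w ≡ true) (fw' : f w' ≡ true) →
  rank f w fw ≡ rank f w' fw' → w ≡ w'
rank-injective f zero zero fw fw' eq = refl
rank-injective {suc n} f (suc w) (suc w') fw fw' eq with f zero
... | true  = cong suc (rank-injective (f ∘ suc) w w' fw fw' (suc-injective eq))
... | false = cong suc (rank-injective (f ∘ suc) w w' fw fw' eq)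
rank-injective {suc n} f zero (suc w') fw fw' eq with f zero
rank-injective f zero (suc w') refl fw' () | true
rank-injective {suc n} f (suc w) zero fw fw' eq with f zero
rank-injective f (suc w) zero fw refl () | true

injection-into-true : ∀ {m n} (f : Fin n → Bool) (g : Fin m → Fin n) →
  (∀ i → f (g i) ≡ true) → (∀ i j → g i ≡ g j → i ≡ j) → m ≤ countTrue f
injection-into-true f g fg g-inj =
  injective⇒≤ λ {i} {j} eq → g-inj i j (rank-injective f (g i) (g j) (fg i) (fg j) eq)

degree-complement : ∀ {n} (G : Graph n) u →
  suc (degree (complement G) u + degree G u) ≡ n
degree-complement G u = begin
  suc (degree (complement G) u) + degree G u    ≡⟨ cong (_+ degree G u) flip ⟩
  countTrue (not ∘ adj G u) + degree G u        ≡⟨ +-comm (countTrue (not ∘ adj G u)) _ ⟩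
  degree G u + countTrue (not ∘ adj G u)        ≡⟨ countTrue-not (adj G u) ⟩
  _ ∎
  where
  open ≡-Reasoning
  off-diagonal : ∀ w → ¬ w ≡ u → adj (complement G) u w ≡ not (adj G u w)
  off-diagonal w w≢u with u ≟ w
  ... | yes u≡w = contradiction (sym u≡w) w≢u
  ... | no _    = refl
  flip : suc (degree (complement G) u) ≡ countTrue (not ∘ adj G u)
  flip = countTrue-flip (adj (complement G) u) (not ∘ adj G u) u
           (adj-irrefl (complement G) u) (cong not (adj-irrefl G u)) off-diagonal

-- If v ∈ S, then m internally disjoint pedant S-Steiner trees meet v in
-- m distinct edges of G (one each, by pendancy), so m ≤ deg v.
disjoint-trees≤degree : ∀ {n} (G : Graph n) (S : Subset n) v → v ∈ S → ∀ m →
  HasDisjointTrees G S m → m ≤ degree G v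
disjoint-trees≤degree G S v v∈S m (T , disjoint) =
  injection-into-true (adj G v) neighbour
    (λ i → E⊆G (tree (T i)) v (neighbour i) (edge i)) neighbour-injective
  where
  pendant-edge : ∀ i → ∃ λ w → E (tree (T i)) v w ≡ true
  pendant-edge i = countTrue-witness (E (tree (T i)) v) (pendant (T i) v v∈S)
  neighbour : Fin m → Fin _
  neighbour i = proj₁ (pendant-edge i)
  edge : ∀ i → E (tree (T i)) v (neighbour i) ≡ true
  edge i = proj₂ (pendant-edge i)
  neighbour-injective : ∀ i j → neighbour i ≡ neighbour j → i ≡ j
  neighbour-injective i j eq with i ≟ j
  ... | yes i≡j = i≡j
  ... | no  i≢j = ⊥-elim (proj₁ (disjoint i j i≢j) v (neighbour j)
                    (subst (λ w → E (tree (T i)) v w ≡ true) eq (edge i) , edge j))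

bounded-maximum : (P : ℕ → Set) → P 0 → (B : ℕ) → (∀ m → P m → m ≤ B) →
  ¬ ¬ (∃ λ s → P s × ¬ P (suc s))
bounded-maximum P P0 B bound no-max = climb (suc B) 0 P0 (s≤s (ℕₚ.≤-reflexive (sym (+-comm B 0))))
  where
  -- starting from P j with B < d + j, the lack of a maximum lets us step
  -- upwards d times to some P j' with B < j', contradicting the bound
  climb : ∀ d j → P j → B < d + j → Empty
  climb zero    j Pj B<j = ℕₚ.<⇒≱ B<j (bound j Pj)
  climb (suc d) j Pj B<d+j =
    no-max (j , Pj , λ Pj+1 → climb d (suc j) Pj+1 (subst (B <_) (sym (+-suc d j)) B<d+j))

subset-of-size : ∀ n j → j ≤ n → ∃ λ (S : Subset n) → ∣ S ∣ ≡ j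
subset-of-size n zero _ = ⊥ , ∣⊥∣≡0 n
subset-of-size (suc n) (suc j) (s≤s j≤n) =
  let (S , ∣S∣≡j) = subset-of-size n j j≤n in true ∷ S , cong suc ∣S∣≡j

subset-of-size-containing : ∀ n k (v : Fin n) → 1 ≤ k → k ≤ n →
  ∃ λ (S : Subset n) → ∣ S ∣ ≡ k × v ∈ S
subset-of-size-containing (suc n) (suc k) zero _ (s≤s k≤n) =
  let (S , ∣S∣≡k) = subset-of-size n k k≤n in true ∷ S , cong suc ∣S∣≡k , here
subset-of-size-containing (suc n) k (suc v) 1≤k k≤1+n with k ≤? n
... | yes k≤n = let (S , ∣S∣≡k , v∈S) = subset-of-size-containing n k v 1≤k k≤n
                in false ∷ S , ∣S∣≡k , there v∈S
... | no  k≰n = ⊤ , trans (∣⊤∣≡n (suc n)) (ℕₚ.≤-antisym (ℕₚ.≰⇒> k≰n) k≤1+n) , ∈⊤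

-- τ_k(G) ≤ deg(v) for every vertex v: take a k-set S ∋ v and a maximum
-- number s of disjoint trees for S; then τ_k(G) ≤ s ≤ deg(v).
tau≤degree : ∀ {n} k (G : Graph n) t v → 1 ≤ k → k ≤ n → IsTau k G t →
  t ≤ degree G v
tau≤degree {n} k G t v 1≤k k≤n (tau≤ , _)
  with subset-of-size-containing n k v 1≤k k≤n
... | S , ∣S∣≡k , v∈S = decidable-stable (t ≤? degree G v) λ t≰deg →
  bounded-maximum (HasDisjointTrees G S) no-trees (degree G v)
    (disjoint-trees≤degree G S v v∈S)
    (λ (s , has-s , ¬has-s+1) → t≰deg (≤-trans (tau≤ S ∣S∣≡k s (has-s , ¬has-s+1))
                                   (disjoint-trees≤degree G S v v∈S s has-s)))
  where
  no-trees : HasDisjointTrees G S 0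
  no-trees = (λ ()) , λ ()

maxF-attained : ∀ {n} (f : Fin (suc n) → ℕ) → ∃ λ u → f u ≡ maxF f
maxF-attained {zero} f = zero , sym (ℕₚ.⊔-identityʳ (f zero))
maxF-attained {suc n} f with maxF-attained (f ∘ suc) | ℕₚ.≤-total (f zero) (maxF (f ∘ suc))
... | u , fu≡max | inj₁ f0≤max = suc u , trans fu≡max (sym (ℕₚ.m≤n⇒m⊔n≡n f0≤max))
... | _ , _      | inj₂ max≤f0 = zero , sym (ℕₚ.m≥n⇒m⊔n≡m max≤f0)

minF-attained : ∀ {n} (f : Fin (suc n) → ℕ) → ∃ λ u → f u ≡ minF f
minF-attained {zero} f = zero , refl
minF-attained {suc n} f with minF-attained (f ∘ suc) | ℕₚ.≤-total (f zero) (minF (f ∘ suc))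
... | _ , _      | inj₁ f0≤min = zero , sym (ℕₚ.m≤n⇒m⊓n≡m f0≤min)
... | u , fu≡min | inj₂ min≤f0 = suc u , trans fu≡min (sym (ℕₚ.m≥n⇒m⊓n≡n min≤f0))

degree-gap : ∀ n k a D d t₁ t₂ → 1 ≤ k → k ≤ n → suc (a + D) ≡ n →
  t₁ ≤ d → t₂ ≤ a → t₁ + t₂ ≡ n ∸ k → D ≤ d + (k ∸ 1)
degree-gap n (suc k) a D d t₁ t₂ _ k≤n a+D+1≡n t₁≤d t₂≤a sum≡ =
  ℕₚ.+-cancelʳ-≤ a D (d + k) (ℕₚ.+-cancelˡ-≤ 1 _ _ (begin
    suc (D + a)         ≡⟨ cong suc (+-comm D a) ⟩
    suc (a + D)         ≡⟨ a+D+1≡n ⟩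
    n                   ≡⟨ sym (ℕₚ.m∸n+n≡m k≤n) ⟩
    n ∸ suc k + suc k   ≡⟨ cong (_+ suc k) (sym sum≡) ⟩
    t₁ + t₂ + suc k     ≤⟨ ℕₚ.+-monoˡ-≤ (suc k) (ℕₚ.+-mono-≤ t₁≤d t₂≤a) ⟩
    d + a + suc k       ≡⟨ +-suc (d + a) k ⟩
    suc (d + a + k)     ≡⟨ cong suc (+-assoc d a k) ⟩
    suc (d + (a + k))   ≡⟨ cong (λ x → suc (d + x)) (+-comm a k) ⟩
    suc (d + (k + a))   ≡⟨ cong suc (sym (+-assoc d k a)) ⟩
    suc (d + k + a)     ∎))
  where open ℕₚ.≤-Reasoning

proposition3 : (n k : ℕ) → 3 ≤ k → k ≤ n → (G : Graph n) →
    (t₁ t₂ : ℕ) → IsTau k G t₁ → IsTau k (complement G) t₂ →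
    t₁ + t₂ ≡ n ∸ k →
    Δ G ≤ δ G + (k ∸ 1)
proposition3 zero k 3≤k k≤0 G t₁ t₂ τ₁ τ₂ sum≡ = ⊥-elim (ℕₚ.<⇒≱ (≤-trans (s≤s z≤n) 3≤k) k≤0)
proposition3 (suc n) k 3≤k k≤n G t₁ t₂ τ₁ τ₂ sum≡ =
  degree-gap (suc n) k (degree (complement G) u) (Δ G) (δ G) t₁ t₂ 1≤k k≤n
    (subst (λ D → suc (degree (complement G) u + D) ≡ suc n) deg-u≡Δ (degree-complement G u))
    (subst (t₁ ≤_) deg-v≡δ (tau≤degree k G t₁ v 1≤k k≤n τ₁))
    (tau≤degree k (complement G) t₂ u 1≤k k≤n τ₂)
    sum≡
  where
  1≤k : 1 ≤ k
  1≤k = ≤-trans (s≤s z≤n) 3≤k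
  u = proj₁ (maxF-attained (degree G))
  deg-u≡Δ : degree G u ≡ Δ G
  deg-u≡Δ = proj₂ (maxF-attained (degree G))
  v = proj₁ (minF-attained (degree G))
  deg-v≡δ : degree G v ≡ δ G
  deg-v≡δ = proj₂ (minF-attained (degree G))
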